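{- Let $c=(c_1,c_2,\dots)$ be a sequence of non-negative integers with finitely many nonzero terms and $|c|\ge1$, and let $j$ be an integer with $0\le j\le |c|-1$. Then $$\sum_{a\in B_c^j}\frac{\|a\|}{|a|}\,h(a)\,h(c-a)=\frac{\|c\|}{|c|}\,h(c).$$
   Context: For a sequence of non-negative integers $a=(a_1,a_2,\dots)$ with finitely many nonzero terms: $\|a\|=\sum_i i a_i$, $|a|=\sum_i a_i$, $h(a)=\frac{|a|!}{\prod_i a_i!}$. For such sequences, $a\le c$ means $a_i\le c_i$ for all $i$, and $c-a$ is the termwise difference. For $0\le j<|c|$, $B_c^j=\{a : a\le c,\ |a|=|c|-j\}$ (sequences of non-negative integers). -}

module Defs where

open import Data.Nat using (ℕ; zero; suc; _+_; _*_; _∸_; _≟_)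
open import Data.Nat using (_!)
open import Data.Integer using (+_)
open import Data.Rational using (ℚ; 0ℚ; _/_) renaming (_+_ to _+q_)
open import Data.List using (List; []; _∷_; map; concatMap; upTo; filter; foldr)
open import Data.Vec using (Vec; []; _∷_; zipWith)

-- A sequence c = (c_1, c_2, …) with finitely many nonzero terms is represented
-- by a vector (c_1, …, c_n) of its first n terms (all later terms are 0).
Seq : ℕ → Set
Seq n = Vec ℕ n

∣_∣ₛ : ∀ {n} → Seq n → ℕ
∣ [] ∣ₛ = 0
∣ x ∷ xs ∣ₛ = x + ∣ xs ∣ₛ

wnorm : ∀ {n} → ℕ → Seq n → ℕ
wnorm k [] = 0
wnorm k (x ∷ xs) = suc k * x + wnorm (suc k) xs

-- ‖a‖ = Σ_i i a_i  (1-based indices)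
‖_‖ₛ : ∀ {n} → Seq n → ℕ
‖ a ‖ₛ = wnorm 0 a

prodFact : ∀ {n} → Seq n → ℕ
prodFact [] = 1
prodFact (x ∷ xs) = (x !) * prodFact xs

-- rational m / q, with the (never used) convention m / 0 = 0
frac : ℕ → ℕ → ℚ
frac m zero = 0ℚ
frac m (suc q) = (+ m) / suc q

h : ∀ {n} → Seq n → ℚ
h a = frac (∣ a ∣ₛ !) (prodFact a)

_−ₛ_ : ∀ {n} → Seq n → Seq n → Seq n
c −ₛ a = zipWith _∸_ c a

below : ∀ {n} → Seq n → List (Seq n)
below [] = [] ∷ []
below (x ∷ xs) = concatMap (λ y → map (y ∷_) (below xs)) (upTo (suc x))

B : ∀ {n} → Seq n → ℕ → List (Seq n)
B c j = filter (λ a → ∣ a ∣ₛ ≟ ∣ c ∣ₛ ∸ j) (below c)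

sumℚ : List ℚ → ℚ
sumℚ = foldr _+q_ 0ℚ

module Submission where

-- Put N = ∣c∣ and m = ∣a∣ = N − j ≥ 1. Since ∏ cᵢ! = ∏ (cᵢ C aᵢ) · ∏ aᵢ! · ∏ (cᵢ − aᵢ)!, the summand for a
-- equals (m − 1)! (N − m)! ‖a‖ ∏ (cᵢ C aᵢ) / ∏ cᵢ!. Comparing coefficients of tᵐ in
-- Σ_{a ≤ c} aᵢ ∏ (cₖ C aₖ) t^∣a∣ = cᵢ t (1 + t)^(N − 1), a weighted Vandermonde convolution, the numerators
-- sum to ‖c‖ ((N − 1) C (m − 1)). As (m − 1)! (N − m)! ((N − 1) C (m − 1)) = (N − 1)!, the whole sum is
-- ‖c‖ (N − 1)! / ∏ cᵢ! = (‖c‖ / N) h(c), whatever j is.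

module Fractions where

  open import Defs
  open import Data.Nat as ℕ using (ℕ; suc; NonZero)
  open import Data.Nat.ListAction using (sum)
  open import Data.Nat.Tactic.RingSolver using (solve-∀)
  open import Data.Integer as ℤ using (+_)
  open import Data.Integer.Properties using (pos-*; pos-+)
  open import Data.List using (List; []; _∷_; map)
  open import Data.Rational using (_+_; _*_; toℚᵘ)
  open import Data.Rational.Properties
    using (toℚᵘ-injective; toℚᵘ-fromℚᵘ; toℚᵘ-homo-*; toℚᵘ-homo-+; fromℚᵘ-cong; 0/n≡0)
  open import Data.Rational.Unnormalised using (*≡*; _≃_) renaming (_/_ to _/ᵘ_; _*_ to _*ᵘ_; _+_ to _+ᵘ_)
  open import Data.Rational.Unnormalised.Properties using (*-cong; +-cong; module ≃-Reasoning)
  open import Relation.Binary.PropositionalEquality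

  private
    variable
      a b c d : ℕ

  /ᵘ-cross : .{{_ : NonZero b}} .{{_ : NonZero d}} → a ℕ.* d ≡ c ℕ.* b → + a /ᵘ b ≃ + c /ᵘ d
  /ᵘ-cross {b = suc _} {d = suc _} {a = a} {c = c} eq =
    *≡* (trans (sym (pos-* a _)) (trans (cong +_ eq) (pos-* c _)))

  toℚᵘ-frac : ∀ a b .{{_ : NonZero b}} → toℚᵘ (frac a b) ≃ + a /ᵘ b
  toℚᵘ-frac a (suc b) = toℚᵘ-fromℚᵘ (+ a /ᵘ suc b)

  frac-cross : .{{_ : NonZero b}} .{{_ : NonZero d}} → a ℕ.* d ≡ c ℕ.* b → frac a b ≡ frac c d
  frac-cross {b = suc _} {d = suc _} {a = a} {c = c} eq = fromℚᵘ-cong (/ᵘ-cross {a = a} {c = c} eq)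

  frac-* : ∀ a b c d .{{_ : NonZero b}} .{{_ : NonZero d}} →
           frac a b * frac c d ≡ frac (a ℕ.* c) (b ℕ.* d)
  frac-* a b@(suc _) c d@(suc _) = toℚᵘ-injective (begin
    toℚᵘ (frac a b * frac c d)            ≈⟨ toℚᵘ-homo-* (frac a b) (frac c d) ⟩
    toℚᵘ (frac a b) *ᵘ toℚᵘ (frac c d)   ≈⟨ *-cong (toℚᵘ-frac a b) (toℚᵘ-frac c d) ⟩
    (+ a /ᵘ b) *ᵘ (+ c /ᵘ d)              ≡⟨ cong (_/ᵘ (b ℕ.* d)) (pos-* a c) ⟨
    + (a ℕ.* c) /ᵘ (b ℕ.* d)              ≈⟨ toℚᵘ-frac (a ℕ.* c) (b ℕ.* d) ⟨
    toℚᵘ (frac (a ℕ.* c) (b ℕ.* d))       ∎)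
    where open ≃-Reasoning

  frac-+ : ∀ a c b .{{_ : NonZero b}} → frac a b + frac c b ≡ frac (a ℕ.+ c) b
  frac-+ a c b@(suc _) = toℚᵘ-injective (begin
    toℚᵘ (frac a b + frac c b)             ≈⟨ toℚᵘ-homo-+ (frac a b) (frac c b) ⟩
    toℚᵘ (frac a b) +ᵘ toℚᵘ (frac c b)    ≈⟨ +-cong (toℚᵘ-frac a b) (toℚᵘ-frac c b) ⟩
    (+ a /ᵘ b) +ᵘ (+ c /ᵘ b)               ≡⟨ cong (_/ᵘ (b ℕ.* b)) pos-numerator ⟨
    + (a ℕ.* b ℕ.+ c ℕ.* b) /ᵘ (b ℕ.* b)   ≈⟨ /ᵘ-cross {a = a ℕ.* b ℕ.+ c ℕ.* b} {c = a ℕ.+ c} (distrib a c b) ⟩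
    + (a ℕ.+ c) /ᵘ b                        ≈⟨ toℚᵘ-frac (a ℕ.+ c) b ⟨
    toℚᵘ (frac (a ℕ.+ c) b)                 ∎)
    where
    open ≃-Reasoning
    pos-numerator : + (a ℕ.* b ℕ.+ c ℕ.* b) ≡ + a ℤ.* + b ℤ.+ + c ℤ.* + b
    pos-numerator = trans (pos-+ (a ℕ.* b) (c ℕ.* b)) (cong₂ ℤ._+_ (pos-* a b) (pos-* c b))
    distrib : ∀ a c b → (a ℕ.* b ℕ.+ c ℕ.* b) ℕ.* b ≡ (a ℕ.+ c) ℕ.* (b ℕ.* b)
    distrib = solve-∀

  sumℚ-frac : ∀ {A : Set} (f : A → ℕ) b .{{_ : NonZero b}} (xs : List A) →
              sumℚ (map (λ x → frac (f x) b) xs) ≡ frac (sum (map f xs)) b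
  sumℚ-frac f b@(suc _) []       = sym (0/n≡0 b)
  sumℚ-frac f b         (x ∷ xs) = trans (cong (_+_ (frac (f x) b)) (sumℚ-frac f b xs)) (frac-+ (f x) _ b)

module BinomialSums where

  open import Data.Nat
  open import Data.Nat.Properties
  open import Data.Nat.Combinatorics
    using (_C_; nCk≡n!/k![n-k]!; k![n∸k]!∣n!; k>n⇒nCk≡0; nCk+nC[k+1]≡[n+1]C[k+1])
  open import Data.Nat.DivMod using (m/n*n≡m)
  open import Data.Nat.ListAction using (sum)
  open import Data.Nat.ListAction.Properties using (sum-++)
  open import Data.Nat.Tactic.RingSolver using (solve-∀)
  open import Algebra.Properties.CommutativeSemigroup +-commutativeSemigroup using (interchange)
  open import Data.List using (List; []; _∷_; _++_; map; concatMap; upTo)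
  open import Data.List.Properties using (map-cong; map-++; map-applyUpTo; upTo-∷ʳ)
  open import Function using (_∘_; id)
  open import Relation.Nullary using (yes; no)
  open import Relation.Binary.PropositionalEquality

  module _ {A : Set} where

    sum-map-+ : ∀ (f g : A → ℕ) xs → sum (map (λ x → f x + g x) xs) ≡ sum (map f xs) + sum (map g xs)
    sum-map-+ f g [] = refl
    sum-map-+ f g (x ∷ xs) = trans (cong (f x + g x +_) (sum-map-+ f g xs)) (interchange (f x) (g x) _ _)

    sum-map-*ˡ : ∀ k (f : A → ℕ) xs → sum (map (λ x → k * f x) xs) ≡ k * sum (map f xs)
    sum-map-*ˡ k f [] = sym (*-zeroʳ k)
    sum-map-*ˡ k f (x ∷ xs) = trans (cong (k * f x +_) (sum-map-*ˡ k f xs)) (sym (*-distribˡ-+ k (f x) _))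

    sum-map-concatMap : ∀ {B : Set} (F : B → ℕ) (g : A → List B) xs →
                        sum (map F (concatMap g xs)) ≡ sum (map (λ x → sum (map F (g x))) xs)
    sum-map-concatMap F g [] = refl
    sum-map-concatMap F g (x ∷ xs) = begin
      sum (map F (g x ++ concatMap g xs))
        ≡⟨ cong sum (map-++ F (g x) _) ⟩
      sum (map F (g x) ++ map F (concatMap g xs))
        ≡⟨ sum-++ (map F (g x)) _ ⟩
      sum (map F (g x)) + sum (map F (concatMap g xs))
        ≡⟨ cong (sum (map F (g x)) +_) (sum-map-concatMap F g xs) ⟩
      sum (map F (g x)) + sum (map (λ x → sum (map F (g x))) xs) ∎
      where open ≡-Reasoning

  Σ< : ℕ → (ℕ → ℕ) → ℕ
  Σ< n f = sum (map f (upTo n))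

  infix 6.5 Σ<
  syntax Σ< n (λ i → e) = Σ[ i < n ] e

  Σ<-cong : ∀ n {f g : ℕ → ℕ} → (∀ i → f i ≡ g i) → Σ< n f ≡ Σ< n g
  Σ<-cong n f≗g = cong sum (map-cong f≗g (upTo n))

  Σ<-suc : ∀ n f → Σ< (suc n) f ≡ f 0 + Σ< n (f ∘ suc)
  Σ<-suc n f = cong (λ xs → f 0 + sum xs)
    (trans (map-applyUpTo suc f n) (sym (map-applyUpTo id (f ∘ suc) n)))

  Σ<-sucʳ : ∀ n f → Σ< (suc n) f ≡ Σ< n f + f n
  Σ<-sucʳ n f = begin
    sum (map f (upTo (suc n)))            ≡⟨ cong (sum ∘ map f) (upTo-∷ʳ n) ⟨
    sum (map f (upTo n ++ n ∷ []))        ≡⟨ cong sum (map-++ f (upTo n) _) ⟩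
    sum (map f (upTo n) ++ f n ∷ [])      ≡⟨ sum-++ (map f (upTo n)) _ ⟩
    Σ< n f + (f n + 0)                    ≡⟨ cong (Σ< n f +_) (+-identityʳ (f n)) ⟩
    Σ< n f + f n                          ∎
    where open ≡-Reasoning

  nCk*k!*[n∸k]!≡n! : ∀ {n k} → k ≤ n → (n C k) * (k ! * (n ∸ k) !) ≡ n !
  nCk*k!*[n∸k]!≡n! {n} {k} k≤n = trans (cong (_* (k ! * (n ∸ k) !)) (nCk≡n!/k![n-k]! k≤n))
    (m/n*n≡m {{k !* (n ∸ k) !≢0}} (k![n∸k]!∣n! k≤n))

  [k+1]*[n+1]C[k+1]≡[n+1]*nCk : ∀ n k → suc k * (suc n C suc k) ≡ suc n * (n C k)
  [k+1]*[n+1]C[k+1]≡[n+1]*nCk n k with k ≤? n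
  ... | yes k≤n = *-cancelʳ-≡ _ _ (k ! * (n ∸ k) !) {{k !* (n ∸ k) !≢0}} (begin
    suc k * (suc n C suc k) * (k ! * (n ∸ k) !)     ≡⟨ rearrange (suc k) (suc n C suc k) (k !) ((n ∸ k) !) ⟩
    (suc n C suc k) * (suc k ! * (suc n ∸ suc k) !)  ≡⟨ nCk*k!*[n∸k]!≡n! (s≤s k≤n) ⟩
    suc n * n !                                       ≡⟨ cong (suc n *_) (nCk*k!*[n∸k]!≡n! k≤n) ⟨
    suc n * ((n C k) * (k ! * (n ∸ k) !))            ≡⟨ *-assoc (suc n) (n C k) _ ⟨
    suc n * (n C k) * (k ! * (n ∸ k) !)              ∎)
    where
    open ≡-Reasoning
    rearrange : ∀ s c f g → s * c * (f * g) ≡ c * (s * f * g)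
    rearrange = solve-∀
  ... | no k≰n rewrite k>n⇒nCk≡0 (s<s (≰⇒> k≰n)) | k>n⇒nCk≡0 (≰⇒> k≰n) =
    trans (*-zeroʳ (suc k)) (sym (*-zeroʳ (suc n)))

  -- shiftC R y m is the coefficient of tᵐ in tʸ (1 + t)ᴿ, i.e. R C (m − y), and 0 when m < y; the offset y lets
  -- sums over the first coordinate of a sequence recurse without truncated subtraction.
  shiftC : ℕ → ℕ → ℕ → ℕ
  shiftC R zero    m       = R C m
  shiftC R (suc y) zero    = 0
  shiftC R (suc y) (suc m) = shiftC R y m

  shiftC-pascal : ∀ R y m → shiftC (suc R) y m ≡ shiftC R y m + shiftC R (suc y) m
  shiftC-pascal R zero    zero    = refl
  shiftC-pascal R zero    (suc m) = trans (sym (nCk+nC[k+1]≡[n+1]C[k+1] R m)) (+-comm (R C m) _)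
  shiftC-pascal R (suc y) zero    = refl
  shiftC-pascal R (suc y) (suc m) = shiftC-pascal R y m

  Σ<-C-pascal : ∀ n (f : ℕ → ℕ) →
    Σ[ z < suc (suc n) ] (suc n C z) * f z ≡ Σ[ z < suc n ] (n C z) * f z + Σ[ z < suc n ] (n C z) * f (suc z)
  Σ<-C-pascal n f = begin
    Σ[ z < suc (suc n) ] (suc n C z) * f z
      ≡⟨ Σ<-suc (suc n) (λ z → (suc n C z) * f z) ⟩
    1 * f 0 + Σ[ z < suc n ] (suc n C suc z) * f (suc z)
      ≡⟨ cong (1 * f 0 +_) (Σ<-cong (suc n) λ z →
           trans (cong (_* f (suc z)) (trans (sym (nCk+nC[k+1]≡[n+1]C[k+1] n z)) (+-comm (n C z) _)))
                 (*-distribʳ-+ (f (suc z)) (n C suc z) (n C z))) ⟩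
    1 * f 0 + Σ[ z < suc n ] ((n C suc z) * f (suc z) + (n C z) * f (suc z))
      ≡⟨ cong (1 * f 0 +_) (sum-map-+ (λ z → (n C suc z) * f (suc z)) (λ z → (n C z) * f (suc z))
                                      (upTo (suc n))) ⟩
    1 * f 0 + (Σ[ z < suc n ] (n C suc z) * f (suc z) + Σ[ z < suc n ] (n C z) * f (suc z))
      ≡⟨ +-assoc (1 * f 0) _ _ ⟨
    1 * f 0 + Σ[ z < suc n ] (n C suc z) * f (suc z) + Σ[ z < suc n ] (n C z) * f (suc z)
      ≡⟨ cong (_+ Σ[ z < suc n ] (n C z) * f (suc z)) (Σ<-suc (suc n) (λ z → (n C z) * f z)) ⟨
    Σ[ z < suc (suc n) ] (n C z) * f z + Σ[ z < suc n ] (n C z) * f (suc z)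
      ≡⟨ cong (_+ Σ[ z < suc n ] (n C z) * f (suc z))
              (trans (Σ<-sucʳ (suc n) (λ z → (n C z) * f z)) vanishing-top) ⟩
    Σ[ z < suc n ] (n C z) * f z + Σ[ z < suc n ] (n C z) * f (suc z) ∎
    where
    open ≡-Reasoning
    vanishing-top : Σ[ z < suc n ] (n C z) * f z + (n C suc n) * f (suc n) ≡ Σ[ z < suc n ] (n C z) * f z
    vanishing-top rewrite k>n⇒nCk≡0 (n<1+n n) = +-identityʳ _

  vandermonde : ∀ x R y m → Σ[ z < suc x ] (x C z) * shiftC R (y + z) m ≡ shiftC (x + R) y m
  vandermonde zero    R y m =
    trans (+-identityʳ _) (trans (*-identityˡ _) (cong (λ t → shiftC R t m) (+-identityʳ y)))
  vandermonde (suc x) R y m = begin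
    Σ[ z < suc (suc x) ] (suc x C z) * shiftC R (y + z) m
      ≡⟨ Σ<-C-pascal x (λ z → shiftC R (y + z) m) ⟩
    Σ[ z < suc x ] (x C z) * shiftC R (y + z) m + Σ[ z < suc x ] (x C z) * shiftC R (y + suc z) m
      ≡⟨ cong₂ _+_ (vandermonde x R y m)
           (trans (Σ<-cong (suc x) λ z → cong (λ t → (x C z) * shiftC R t m) (+-suc y z))
                  (vandermonde x R (suc y) m)) ⟩
    shiftC (x + R) y m + shiftC (x + R) (suc y) m
      ≡⟨ shiftC-pascal (x + R) y m ⟨
    shiftC (suc x + R) y m ∎
    where open ≡-Reasoning

  vandermonde-weighted : ∀ x R y m →
    Σ[ z < suc x ] z * (x C z) * shiftC R (y + z) m ≡ x * shiftC (x + R ∸ 1) (suc y) m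
  vandermonde-weighted zero    R y m = refl
  vandermonde-weighted (suc x) R y m = begin
    Σ[ z < suc (suc x) ] z * (suc x C z) * shiftC R (y + z) m
      ≡⟨ Σ<-suc (suc x) (λ z → z * (suc x C z) * shiftC R (y + z) m) ⟩
    Σ[ z < suc x ] suc z * (suc x C suc z) * shiftC R (y + suc z) m
      ≡⟨ Σ<-cong (suc x) (λ z → cong₂ _*_ ([k+1]*[n+1]C[k+1]≡[n+1]*nCk x z)
                                         (cong (λ t → shiftC R t m) (+-suc y z))) ⟩
    Σ[ z < suc x ] suc x * (x C z) * shiftC R (suc y + z) m
      ≡⟨ Σ<-cong (suc x) (λ z → *-assoc (suc x) (x C z) _) ⟩
    Σ[ z < suc x ] suc x * ((x C z) * shiftC R (suc y + z) m)
      ≡⟨ sum-map-*ˡ (suc x) (λ z → (x C z) * shiftC R (suc y + z) m) (upTo (suc x)) ⟩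
    suc x * (Σ[ z < suc x ] (x C z) * shiftC R (suc y + z) m)
      ≡⟨ cong (suc x *_) (vandermonde x R (suc y) m) ⟩
    suc x * shiftC (x + R) (suc y) m ∎
    where open ≡-Reasoning

module SequenceSums where

  open import Defs
  open BinomialSums
  open import Data.Nat
  open import Data.Nat.Properties
  open import Data.Nat.Combinatorics using (_C_)
  open import Data.Nat.ListAction using (sum)
  open import Data.Nat.Tactic.RingSolver using (solve-∀)
  open import Algebra.Properties.CommutativeSemigroup +-commutativeSemigroup using (interchange)
  open import Algebra.Properties.CommutativeSemigroup *-commutativeSemigroup using (x∙yz≈y∙xz)
  open import Data.Product using (_×_; _,_)
  open import Data.Vec using ([]; _∷_)
  open import Data.Vec.Relation.Binary.Pointwise.Inductive using (Pointwise; []; _∷_)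
  open import Data.List using (List; []; _∷_; map; filter; upTo)
  open import Data.List.Properties using (map-cong; map-∘; filter-accept; filter-reject)
  open import Data.List.Relation.Unary.All as All using (All; []; _∷_)
  open import Data.List.Relation.Unary.All.Properties
    using (concat⁺; map⁺; applyUpTo⁺₁; all-filter; filter⁺)
  open import Function using (_∘_; id)
  open import Relation.Nullary using (yes; no; contradiction)
  open import Relation.Binary.PropositionalEquality

  private
    variable
      n : ℕ

  _≤ₛ_ : Seq n → Seq n → Set
  _≤ₛ_ = Pointwise _≤_

  _Cₛ_ : Seq n → Seq n → ℕ
  []      Cₛ []      = 1
  (x ∷ c) Cₛ (y ∷ a) = (x C y) * (c Cₛ a)

  δ : ℕ → ℕ → ℕ
  δ = shiftC 0

  δ-refl : ∀ i → δ i i ≡ 1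
  δ-refl zero    = refl
  δ-refl (suc i) = δ-refl i

  δ-≢ : ∀ {i j} → i ≢ j → δ i j ≡ 0
  δ-≢ {zero}  {zero}  i≢j = contradiction refl i≢j
  δ-≢ {zero}  {suc j} _   = refl
  δ-≢ {suc i} {zero}  _   = refl
  δ-≢ {suc i} {suc j} i≢j = δ-≢ (i≢j ∘ cong suc)

  sum-filter-δ : ∀ {A : Set} (g f : A → ℕ) m xs →
    sum (map f (filter (λ x → g x ≟ m) xs)) ≡ sum (map (λ x → δ (g x) m * f x) xs)
  sum-filter-δ g f m [] = refl
  sum-filter-δ g f m (x ∷ xs) with g x ≟ m
  ... | yes gx≡m = begin
    sum (map f (filter P? (x ∷ xs)))
      ≡⟨ cong (sum ∘ map f) (filter-accept P? gx≡m) ⟩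
    f x + sum (map f (filter P? xs))
      ≡⟨ cong₂ _+_ (sym (*-identityˡ (f x))) (sum-filter-δ g f m xs) ⟩
    1 * f x + sum (map (λ x → δ (g x) m * f x) xs)
      ≡⟨ cong (λ e → e * f x + _) (trans (sym (δ-refl m)) (cong (λ i → δ i m) (sym gx≡m))) ⟩
    δ (g x) m * f x + sum (map (λ x → δ (g x) m * f x) xs) ∎
    where
    open ≡-Reasoning
    P? = λ x → g x ≟ m
  ... | no gx≢m rewrite δ-≢ gx≢m =
    trans (cong (sum ∘ map f) (filter-reject (λ x → g x ≟ m) gx≢m)) (sum-filter-δ g f m xs)

  below-≤ₛ : (c : Seq n) → All (_≤ₛ c) (below c)
  below-≤ₛ []      = [] ∷ []
  below-≤ₛ (x ∷ c) = concat⁺ (map⁺ (applyUpTo⁺₁ id (suc x) λ z<1+x →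
    map⁺ (All.map (s≤s⁻¹ z<1+x ∷_) (below-≤ₛ c))))

  sum-below-∷ : ∀ x (c : Seq n) (F : Seq (suc n) → ℕ) →
    sum (map F (below (x ∷ c))) ≡ Σ[ z < suc x ] sum (map (λ a → F (z ∷ a)) (below c))
  sum-below-∷ x c F = trans (sum-map-concatMap F (λ z → map (z ∷_) (below c)) (upTo (suc x)))
    (Σ<-cong (suc x) λ z → cong sum (sym (map-∘ (below c))))

  level : Seq n → ℕ → List (Seq n)
  level c m = filter (λ a → ∣ a ∣ₛ ≟ m) (below c)

  level-members : (c : Seq n) (m : ℕ) → All (λ a → a ≤ₛ c × ∣ a ∣ₛ ≡ m) (level c m)
  level-members c m = All.zip (filter⁺ P? (below-≤ₛ c) , all-filter P? (below c))
    where P? = λ (a : Seq _) → ∣ a ∣ₛ ≟ m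

  ∣−ₛ∣+∣∣ : {a c : Seq n} → a ≤ₛ c → ∣ c −ₛ a ∣ₛ + ∣ a ∣ₛ ≡ ∣ c ∣ₛ
  ∣−ₛ∣+∣∣ []                          = refl
  ∣−ₛ∣+∣∣ {a = y ∷ a} {x ∷ c} (y≤x ∷ a≤c) = begin
    (x ∸ y) + ∣ c −ₛ a ∣ₛ + (y + ∣ a ∣ₛ)     ≡⟨ interchange (x ∸ y) _ y _ ⟩
    (x ∸ y + y) + (∣ c −ₛ a ∣ₛ + ∣ a ∣ₛ)     ≡⟨ cong₂ _+_ (m∸n+n≡m y≤x) (∣−ₛ∣+∣∣ a≤c) ⟩
    x + ∣ c ∣ₛ                                ∎
    where open ≡-Reasoning

  ∣−ₛ∣ : {a c : Seq n} → a ≤ₛ c → ∣ c −ₛ a ∣ₛ ≡ ∣ c ∣ₛ ∸ ∣ a ∣ₛ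
  ∣−ₛ∣ {a = a} {c} a≤c =
    trans (sym (m+n∸n≡m ∣ c −ₛ a ∣ₛ ∣ a ∣ₛ)) (cong (_∸ ∣ a ∣ₛ) (∣−ₛ∣+∣∣ a≤c))

  prodFact≢0 : (a : Seq n) → NonZero (prodFact a)
  prodFact≢0 []      = _
  prodFact≢0 (x ∷ a) = m*n≢0 (x !) (prodFact a) {{x !≢0}} {{prodFact≢0 a}}

  prodFact-split : {a c : Seq n} → a ≤ₛ c → prodFact c ≡ (c Cₛ a) * (prodFact a * prodFact (c −ₛ a))
  prodFact-split []                          = refl
  prodFact-split {a = y ∷ a} {x ∷ c} (y≤x ∷ a≤c) = begin
    x ! * prodFact c
      ≡⟨ cong₂ _*_ (nCk*k!*[n∸k]!≡n! y≤x) (sym (prodFact-split a≤c)) ⟨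
    (x C y) * (y ! * (x ∸ y) !) * ((c Cₛ a) * (prodFact a * prodFact (c −ₛ a)))
      ≡⟨ regroup (x C y) (y !) ((x ∸ y) !) (c Cₛ a) (prodFact a) (prodFact (c −ₛ a)) ⟩
    (x C y) * (c Cₛ a) * (y ! * prodFact a * ((x ∸ y) ! * prodFact (c −ₛ a))) ∎
    where
    open ≡-Reasoning
    regroup : ∀ b f g B p q → b * (f * g) * (B * (p * q)) ≡ b * B * (f * p * (g * q))
    regroup = solve-∀

  sum-δ-slice : ∀ X (F : Seq n → ℕ) y z m (as : List (Seq n)) →
    sum (map (λ a → δ (y + (z + ∣ a ∣ₛ)) m * (X * F a)) as)
      ≡ X * sum (map (λ a → δ (y + z + ∣ a ∣ₛ) m * F a) as)
  sum-δ-slice X F y z m as =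
    trans (cong sum (map-cong moveX as)) (sum-map-*ˡ X (λ a → δ (y + z + ∣ a ∣ₛ) m * F a) as)
    where
    moveX : ∀ a → δ (y + (z + ∣ a ∣ₛ)) m * (X * F a) ≡ X * (δ (y + z + ∣ a ∣ₛ) m * F a)
    moveX a = trans (cong (λ i → δ i m * (X * F a)) (sym (+-assoc y z ∣ a ∣ₛ)))
                    (x∙yz≈y∙xz (δ (y + z + ∣ a ∣ₛ) m) X (F a))

  vandermondeₛ : ∀ (c : Seq n) y m →
    sum (map (λ a → δ (y + ∣ a ∣ₛ) m * (c Cₛ a)) (below c)) ≡ shiftC ∣ c ∣ₛ y m
  vandermondeₛ []      y m =
    trans (+-identityʳ _) (trans (*-identityʳ _) (cong (λ i → δ i m) (+-identityʳ y)))
  vandermondeₛ (x ∷ c) y m = begin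
    sum (map (λ a → δ (y + ∣ a ∣ₛ) m * ((x ∷ c) Cₛ a)) (below (x ∷ c)))
      ≡⟨ sum-below-∷ x c (λ a → δ (y + ∣ a ∣ₛ) m * ((x ∷ c) Cₛ a)) ⟩
    Σ[ z < suc x ] sum (map (λ a → δ (y + (z + ∣ a ∣ₛ)) m * ((x C z) * (c Cₛ a))) (below c))
      ≡⟨ Σ<-cong (suc x) (λ z → trans (sum-δ-slice (x C z) (c Cₛ_) y z m (below c))
                                       (cong ((x C z) *_) (vandermondeₛ c (y + z) m))) ⟩
    Σ[ z < suc x ] (x C z) * shiftC ∣ c ∣ₛ (y + z) m
      ≡⟨ vandermonde x ∣ c ∣ₛ y m ⟩
    shiftC (x + ∣ c ∣ₛ) y m ∎
    where open ≡-Reasoning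

  ∣a∣≡0⇒wnorm≡0 : ∀ k (a : Seq n) → ∣ a ∣ₛ ≡ 0 → wnorm k a ≡ 0
  ∣a∣≡0⇒wnorm≡0 k []      _ = refl
  ∣a∣≡0⇒wnorm≡0 k (x ∷ a) e = begin
    suc k * x + wnorm (suc k) a
      ≡⟨ cong₂ (λ u v → suc k * u + v) (m+n≡0⇒m≡0 x e) (∣a∣≡0⇒wnorm≡0 (suc k) a (m+n≡0⇒n≡0 x e)) ⟩
    suc k * 0 + 0
      ≡⟨ trans (+-identityʳ _) (*-zeroʳ (suc k)) ⟩
    0 ∎
    where open ≡-Reasoning

  -- For ∣ c ∣ₛ = 0 the two truncated subtractions differ, but then the weight vanishes.
  wnorm*shiftC-pred : ∀ x k (c : Seq n) s m →
    wnorm k c * shiftC (x + (∣ c ∣ₛ ∸ 1)) s m ≡ wnorm k c * shiftC (x + ∣ c ∣ₛ ∸ 1) s m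
  wnorm*shiftC-pred x k c s m with ∣ c ∣ₛ in ∣c∣≡
  ... | zero  rewrite ∣a∣≡0⇒wnorm≡0 k c ∣c∣≡ = refl
  ... | suc R = cong (λ t → wnorm k c * shiftC (t ∸ 1) s m) (sym (+-suc x R))

  vandermonde-weightedₛ : ∀ (c : Seq n) k y m →
    sum (map (λ a → δ (y + ∣ a ∣ₛ) m * (wnorm k a * (c Cₛ a))) (below c))
      ≡ wnorm k c * shiftC (∣ c ∣ₛ ∸ 1) (suc y) m
  vandermonde-weightedₛ []      k y m = cong (_+ 0) (*-zeroʳ (δ (y + 0) m))
  vandermonde-weightedₛ (x ∷ c) k y m = begin
    sum (map (λ a → δ (y + ∣ a ∣ₛ) m * (wnorm k a * ((x ∷ c) Cₛ a))) (below (x ∷ c)))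
      ≡⟨ sum-below-∷ x c (λ a → δ (y + ∣ a ∣ₛ) m * (wnorm k a * ((x ∷ c) Cₛ a))) ⟩
    Σ[ z < suc x ] sum (map (λ a → δ (y + (z + ∣ a ∣ₛ)) m * ((s * z + w a) * ((x C z) * (c Cₛ a)))) (below c))
      ≡⟨ Σ<-cong (suc x) slice ⟩
    Σ[ z < suc x ] (s * (z * (x C z) * shiftC R (y + z) m) + w c * ((x C z) * shiftC (R ∸ 1) (suc y + z) m))
      ≡⟨ sum-map-+ (λ z → s * (z * (x C z) * shiftC R (y + z) m))
                   (λ z → w c * ((x C z) * shiftC (R ∸ 1) (suc y + z) m)) (upTo (suc x)) ⟩
    Σ[ z < suc x ] s * (z * (x C z) * shiftC R (y + z) m)
      + Σ[ z < suc x ] w c * ((x C z) * shiftC (R ∸ 1) (suc y + z) m)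
      ≡⟨ cong₂ _+_ (sum-map-*ˡ s (λ z → z * (x C z) * shiftC R (y + z) m) (upTo (suc x)))
                   (sum-map-*ˡ (w c) (λ z → (x C z) * shiftC (R ∸ 1) (suc y + z) m) (upTo (suc x))) ⟩
    s * (Σ[ z < suc x ] z * (x C z) * shiftC R (y + z) m)
      + w c * (Σ[ z < suc x ] (x C z) * shiftC (R ∸ 1) (suc y + z) m)
      ≡⟨ cong₂ (λ u v → s * u + w c * v) (vandermonde-weighted x R y m) (vandermonde x (R ∸ 1) (suc y) m) ⟩
    s * (x * S) + w c * shiftC (x + (R ∸ 1)) (suc y) m
      ≡⟨ cong (s * (x * S) +_) (wnorm*shiftC-pred x (suc k) c (suc y) m) ⟩
    s * (x * S) + w c * S
      ≡⟨ factor s x (w c) S ⟩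
    (s * x + w c) * S ∎
    where
    open ≡-Reasoning
    R = ∣ c ∣ₛ
    s = suc k
    w = wnorm (suc k)
    S = shiftC (x + R ∸ 1) (suc y) m
    factor : ∀ s x w S → s * (x * S) + w * S ≡ (s * x + w) * S
    factor = solve-∀
    split : ∀ d s z w B → d * ((s * z + w) * B) ≡ s * z * (d * B) + d * (w * B)
    split = solve-∀
    regroup : ∀ s z X V w W → X * (s * z * V + w * W) ≡ s * (z * X * V) + w * (X * W)
    regroup = solve-∀
    slice : ∀ z → sum (map (λ a → δ (y + (z + ∣ a ∣ₛ)) m * ((s * z + w a) * ((x C z) * (c Cₛ a)))) (below c))
                ≡ s * (z * (x C z) * shiftC R (y + z) m) + w c * ((x C z) * shiftC (R ∸ 1) (suc y + z) m)
    slice z = begin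
      sum (map (λ a → δ (y + (z + ∣ a ∣ₛ)) m * ((s * z + w a) * (X * (c Cₛ a)))) (below c))
        ≡⟨ cong sum (map-cong (λ a → cong (δ (y + (z + ∣ a ∣ₛ)) m *_) (x∙yz≈y∙xz (s * z + w a) X (c Cₛ a)))
                              (below c)) ⟩
      sum (map (λ a → δ (y + (z + ∣ a ∣ₛ)) m * (X * ((s * z + w a) * (c Cₛ a)))) (below c))
        ≡⟨ sum-δ-slice X (λ a → (s * z + w a) * (c Cₛ a)) y z m (below c) ⟩
      X * Σδ (λ a → (s * z + w a) * (c Cₛ a))
        ≡⟨ cong (X *_) (trans (cong sum (map-cong (λ a → split (δ' a) s z (w a) (c Cₛ a)) (below c)))
                              (sum-map-+ (λ a → s * z * (δ' a * (c Cₛ a))) (λ a → δ' a * (w a * (c Cₛ a))) (below c))) ⟩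
      X * (sum (map (λ a → s * z * (δ' a * (c Cₛ a))) (below c)) + Σδ (λ a → w a * (c Cₛ a)))
        ≡⟨ cong (λ u → X * (u + Σδ (λ a → w a * (c Cₛ a)))) (sum-map-*ˡ (s * z) (λ a → δ' a * (c Cₛ a)) (below c)) ⟩
      X * (s * z * Σδ (c Cₛ_) + Σδ (λ a → w a * (c Cₛ a)))
        ≡⟨ cong₂ (λ u v → X * (s * z * u + v)) (vandermondeₛ c (y + z) m) (vandermonde-weightedₛ c s (y + z) m) ⟩
      X * (s * z * shiftC R (y + z) m + w c * shiftC (R ∸ 1) (suc y + z) m)
        ≡⟨ regroup s z X (shiftC R (y + z) m) (w c) (shiftC (R ∸ 1) (suc y + z) m) ⟩
      s * (z * X * shiftC R (y + z) m) + w c * (X * shiftC (R ∸ 1) (suc y + z) m) ∎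
      where
      X = x C z
      δ' = λ (a : Seq _) → δ (y + z + ∣ a ∣ₛ) m
      Σδ : (Seq _ → ℕ) → ℕ
      Σδ F = sum (map (λ a → δ' a * F a) (below c))

  level-norm-sum : ∀ (c : Seq n) m →
    sum (map (λ a → ‖ a ‖ₛ * (c Cₛ a)) (level c (suc m))) ≡ ‖ c ‖ₛ * ((∣ c ∣ₛ ∸ 1) C m)
  level-norm-sum c m = trans (sum-filter-δ ∣_∣ₛ (λ a → ‖ a ‖ₛ * (c Cₛ a)) (suc m) (below c))
                             (vandermonde-weightedₛ c 0 0 (suc m))

module LevelSums where

  open import Defs
  open Fractions
  open BinomialSums using (nCk*k!*[n∸k]!≡n!; sum-map-*ˡ)
  open SequenceSums
  open import Data.Nat
  open import Data.Nat.Properties using (m*n≢0)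
  open import Data.Nat.Combinatorics using (_C_)
  open import Data.Nat.ListAction using (sum)
  open import Data.Nat.Tactic.RingSolver using (solve-∀)
  open import Data.Product using (uncurry)
  open import Data.List using (map)
  open import Data.List.Properties using (map-cong-local)
  open import Data.List.Relation.Unary.All as All using ()
  open import Data.Rational using (ℚ) renaming (_*_ to _*ℚ_)
  open import Relation.Binary.PropositionalEquality

  private
    variable
      n : ℕ

  term : Seq n → Seq n → ℚ
  term c a = frac ‖ a ‖ₛ ∣ a ∣ₛ *ℚ h a *ℚ h (c −ₛ a)

  frac-*-factorials : ∀ w m t p q B {P} .{{_ : NonZero p}} .{{_ : NonZero q}} .{{_ : NonZero P}} →
    P ≡ B * (p * q) →
    frac w (suc m) *ℚ frac (suc m !) p *ℚ frac (t !) q ≡ frac (m ! * t ! * (w * B)) P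
  frac-*-factorials w m t p q B refl = begin
    frac w (suc m) *ℚ frac (suc m !) p *ℚ frac (t !) q
      ≡⟨ cong (_*ℚ frac (t !) q) (frac-* w (suc m) (suc m !) p) ⟩
    frac (w * suc m !) (suc m * p) *ℚ frac (t !) q
      ≡⟨ frac-* (w * suc m !) (suc m * p) (t !) q {{m*n≢0 (suc m) p}} ⟩
    frac (w * suc m ! * t !) (suc m * p * q)
      ≡⟨ frac-cross {{m*n≢0 (suc m * p) q {{m*n≢0 (suc m) p}}}} (cross w m (m !) (t !) p q B) ⟩
    frac (m ! * t ! * (w * B)) (B * (p * q)) ∎
    where
    open ≡-Reasoning
    cross : ∀ w m f g p q B → w * (suc m * f) * g * (B * (p * q)) ≡ f * g * (w * B) * (suc m * p * q)
    cross = solve-∀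

  level-term : {a c : Seq n} {m : ℕ} → a ≤ₛ c → ∣ a ∣ₛ ≡ suc m →
    term c a ≡ frac (m ! * (∣ c ∣ₛ ∸ suc m) ! * (‖ a ‖ₛ * (c Cₛ a))) (prodFact c)
  level-term {a = a} {c} {m} a≤c ∣a∣≡ = begin
    frac ‖ a ‖ₛ ∣ a ∣ₛ *ℚ frac (∣ a ∣ₛ !) (prodFact a) *ℚ frac (∣ c −ₛ a ∣ₛ !) (prodFact (c −ₛ a))
      ≡⟨ cong₂ (λ s t → frac ‖ a ‖ₛ s *ℚ frac (s !) (prodFact a) *ℚ frac (t !) (prodFact (c −ₛ a)))
               ∣a∣≡ (trans (∣−ₛ∣ a≤c) (cong (∣ c ∣ₛ ∸_) ∣a∣≡)) ⟩
    frac ‖ a ‖ₛ (suc m) *ℚ frac (suc m !) (prodFact a) *ℚ frac ((∣ c ∣ₛ ∸ suc m) !) (prodFact (c −ₛ a))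
      ≡⟨ frac-*-factorials ‖ a ‖ₛ m (∣ c ∣ₛ ∸ suc m) (prodFact a) (prodFact (c −ₛ a)) (c Cₛ a)
                           (prodFact-split a≤c) ⟩
    frac (m ! * (∣ c ∣ₛ ∸ suc m) ! * (‖ a ‖ₛ * (c Cₛ a))) (prodFact c) ∎
    where
    open ≡-Reasoning
    instance
      _ = prodFact≢0 a
      _ = prodFact≢0 (c −ₛ a)
      _ = prodFact≢0 c

  frac-total : ∀ w m {R} P .{{_ : NonZero P}} → suc m ≤ R →
    frac (m ! * (R ∸ suc m) ! * (w * ((R ∸ 1) C m))) P ≡ frac w R *ℚ frac (R !) P
  frac-total w m P (s≤s {n = N} m≤N) = sym (begin
    frac w (suc N) *ℚ frac (suc N !) P
      ≡⟨ frac-* w (suc N) (suc N !) P ⟩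
    frac (w * (suc N * N !)) (suc N * P)
      ≡⟨ cong (λ f → frac (w * (suc N * f)) (suc N * P)) (nCk*k!*[n∸k]!≡n! m≤N) ⟨
    frac (w * (suc N * ((N C m) * (m ! * (N ∸ m) !)))) (suc N * P)
      ≡⟨ frac-cross {{m*n≢0 (suc N) P}} (cross w N (N C m) (m !) ((N ∸ m) !) P) ⟩
    frac (m ! * (N ∸ m) ! * (w * (N C m))) P ∎)
    where
    open ≡-Reasoning
    cross : ∀ w N C f g P → w * (suc N * (C * (f * g))) * P ≡ f * g * (w * C) * (suc N * P)
    cross = solve-∀

  level-sum : (c : Seq n) (m : ℕ) → 0 < m → m ≤ ∣ c ∣ₛ →
    sumℚ (map (term c) (level c m)) ≡ frac ‖ c ‖ₛ ∣ c ∣ₛ *ℚ h c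
  level-sum c (suc m) _ m<∣c∣ = begin
    sumℚ (map (term c) (level c (suc m)))
      ≡⟨ cong sumℚ (map-cong-local (All.map (uncurry level-term) (level-members c (suc m)))) ⟩
    sumℚ (map (λ a → frac (K * (‖ a ‖ₛ * (c Cₛ a))) (prodFact c)) (level c (suc m)))
      ≡⟨ sumℚ-frac (λ a → K * (‖ a ‖ₛ * (c Cₛ a))) (prodFact c) (level c (suc m)) ⟩
    frac (sum (map (λ a → K * (‖ a ‖ₛ * (c Cₛ a))) (level c (suc m)))) (prodFact c)
      ≡⟨ cong (λ s → frac s (prodFact c)) (trans (sum-map-*ˡ K (λ a → ‖ a ‖ₛ * (c Cₛ a)) (level c (suc m)))
                                                  (cong (K *_) (level-norm-sum c m))) ⟩
    frac (K * (‖ c ‖ₛ * ((∣ c ∣ₛ ∸ 1) C m))) (prodFact c)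
      ≡⟨ frac-total ‖ c ‖ₛ m (prodFact c) m<∣c∣ ⟩
    frac ‖ c ‖ₛ ∣ c ∣ₛ *ℚ h c ∎
    where
    open ≡-Reasoning
    K = m ! * (∣ c ∣ₛ ∸ suc m) !
    instance _ = prodFact≢0 c

open import Defs
open import Data.Nat using (ℕ; _≤_; _<_; _∸_)
open import Data.Nat.Properties using (m<n⇒0<n∸m; m∸n≤m)
open import Data.Rational using (ℚ; _*_)
open import Data.List using (map)
open import Relation.Binary.PropositionalEquality using (_≡_)
open LevelSums using (level-sum)

lemma3p12 : (n : ℕ) (c : Seq n) (j : ℕ) → 1 ≤ ∣ c ∣ₛ → j < ∣ c ∣ₛ →
    sumℚ (map (λ a → frac ‖ a ‖ₛ ∣ a ∣ₛ * h a * h (c −ₛ a)) (B c j))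
    ≡ frac ‖ c ‖ₛ ∣ c ∣ₛ * h c
-- The summand and B c j unfold to term c and level c (∣ c ∣ₛ ∸ j).
lemma3p12 n c j _ j<∣c∣ = level-sum c (∣ c ∣ₛ ∸ j) (m<n⇒0<n∸m j<∣c∣) (m∸n≤m ∣ c ∣ₛ j)
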